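{- Let $\mathcal{G}$ be an RDF graph and $\mathcal{C}$ a stratified SSL catalogue, and let $\Omega=\mathrm{dom}(\mathcal{C})\times(\mathsf{Nodes}(\mathcal{G})\cup\mathsf{Const}(\mathcal{C}))$. Then for every shape assignment $\alpha$ for $\mathcal{G}$ and $\mathcal{C}$: $\alpha$ LFP-conforms to $\mathcal{C}$ if and only if $\Omega\setminus\alpha$ GFP-conforms to the dual catalogue $\widetilde{\mathcal{C}}$.
   Context: An RDF graph $\mathcal{G}$ is a finite set of triples $(u,p,v)$ with $u\in\mathsf{IRIs}\cup\mathsf{Blanks}$, $p\in\mathsf{IRIs}$, $v\in\mathsf{IRIs}\cup\mathsf{Blanks}\cup\mathsf{Literals}$ (countable pairwise disjoint sets); $\mathsf{Nodes}(\mathcal{G})$ is the set of elements occurring in subject or object position of a triple of $\mathcal{G}$. Fix a countable set $\mathsf{Names}$ of shape names. SSL shapes are given by $\varphi::=\bot\mid\top\mid\mathsf{test}(c)\mid s\mid\neg\varphi\mid\varphi\lor\varphi\mid\varphi\land\varphi\mid\exists p.\varphi\mid\forall p.\varphi$ with $s\in\mathsf{Names}$, $p\in\mathsf{IRIs}$, $c\in\mathsf{IRIs}\cup\mathsf{Literals}$. An SSL catalogue $\mathcal{C}$ is a partial function from $\mathsf{Names}$ to shapes with finite domain $\mathrm{dom}(\mathcal{C})$ such that every shape name occurring in some $\mathcal{C}(s)$ belongs to $\mathrm{dom}(\mathcal{C})$; $\mathsf{Const}(\mathcal{C})$ is the set of $c$ such that $\mathsf{test}(c)$ occurs in $\mathcal{C}$.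 Let $N=\mathsf{Nodes}(\mathcal{G})\cup\mathsf{Const}(\mathcal{C})$. A shape assignment is a relation $\alpha\subseteq\mathrm{dom}(\mathcal{C})\times N$; write $\alpha(s)=\{u\mid(s,u)\in\alpha\}$. The semantics $[\![\varphi]\!]^{\mathcal{G}}_\alpha\subseteq N$ is: $[\![\bot]\!]=\emptyset$, $[\![\top]\!]=N$, $[\![\mathsf{test}(c)]\!]=\{c\}$, $[\![s]\!]=\alpha(s)$, $[\![\neg\varphi]\!]=N\setminus[\![\varphi]\!]$, $\lor$ is union, $\land$ is intersection, $[\![\exists p.\varphi]\!]=\{u\mid\text{for some }(u,p,v)\in\mathcal{G},\ v\in[\![\varphi]\!]\}$, $[\![\forall p.\varphi]\!]=\{u\in N\mid\text{for all }(u,p,v)\in\mathcal{G},\ v\in[\![\varphi]\!]\}$. $\alpha$ is correct for $\mathcal{C}$ if $\alpha(s)=[\![\mathcal{C}(s)]\!]^{\mathcal{G}}_\alpha$ for all $s\in\mathrm{dom}(\mathcal{C})$. A stratification of $\mathcal{C}$ is a partition $\Sigma_0,\dots,\Sigma_n$ of $\mathrm{dom}(\mathcal{C})$ such that for every $i$, the declarations $\mathcal{C}(s)$ with $s\in\Sigma_i$ use only shape names from $\Sigma_0\cup\dots\cup\Sigma_i$ and use negation only in subexpressions $\neg\mathsf{test}(c)$ and $\neg s'$ with $s'\in\Sigma_0\cup\dots\cup\Sigma_{i-1}$; $\mathcal{C}$ is stratified if it has a stratification. Given a stratification, let $\mathcal{C}_i$ be the restriction of $\mathcal{C}$ to $\Sigma_0\cup\dots\cup\Sigma_i$,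 and define iteratively $\alpha_i\subseteq\Sigma_i\times N$ as the least (w.r.t. $\subseteq$) assignment over $\Sigma_i$ such that $\alpha_0\cup\dots\cup\alpha_i$ is correct for $\mathcal{C}_i$; the assignment $\alpha_0\cup\dots\cup\alpha_n$ is the unique one that LFP-conforms to $\mathcal{C}$. GFP-conformance is defined the same way with "largest" instead of "least". The dual catalogue is $\widetilde{\mathcal{C}}=\{s:\widetilde{\varphi}\mid \mathcal{C}(s)=\varphi\}$, where $\widetilde{\bot}=\top$, $\widetilde{\top}=\bot$, $\widetilde{\mathsf{test}(c)}=\neg\mathsf{test}(c)$, $\widetilde{\neg\mathsf{test}(c)}=\mathsf{test}(c)$, $\widetilde{s}=s$, $\widetilde{\neg s}=\neg s$, $\widetilde{\varphi_1\land\varphi_2}=\widetilde{\varphi_1}\lor\widetilde{\varphi_2}$, $\widetilde{\varphi_1\lor\varphi_2}=\widetilde{\varphi_1}\land\widetilde{\varphi_2}$, $\widetilde{\exists p.\varphi}=\forall p.\widetilde{\varphi}$, $\widetilde{\forall p.\varphi}=\exists p.\widetilde{\varphi}$. -}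

module Defs where

open import Data.Nat using (ℕ; _≤_; _<_; _≡ᵇ_; _<ᵇ_)
open import Data.Bool using (Bool; true; false; _∧_; _∨_; not; if_then_else_)
open import Data.List using (List; []; _∷_; _++_; concatMap; map)
open import Data.Bool.ListAction using (any; all)
open import Data.List.Membership.Propositional using (_∈_)
open import Data.Product using (Σ; _×_; _,_)
open import Relation.Binary.PropositionalEquality using (_≡_)

IRI : Set
IRI = ℕ

data Term : Set where
  iri   : ℕ → Term
  blank : ℕ → Term
  lit   : ℕ → Term

data Subj : Set where
  sIri   : ℕ → Subj
  sBlank : ℕ → Subj

subjTerm : Subj → Term
subjTerm (sIri n)   = iri n
subjTerm (sBlank n) = blank n

data Const : Set where
  cIri : ℕ → Const
  cLit : ℕ → Const

constTerm : Const → Term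
constTerm (cIri n) = iri n
constTerm (cLit n) = lit n

_==T_ : Term → Term → Bool
iri m   ==T iri n   = m ≡ᵇ n
blank m ==T blank n = m ≡ᵇ n
lit m   ==T lit n   = m ≡ᵇ n
_       ==T _       = false

record Triple : Set where
  constructor ⟨_,_,_⟩
  field
    subj : Subj
    pred : IRI
    obj  : Term
open Triple public

Graph : Set
Graph = List Triple

Nodes : Graph → List Term
Nodes G = concatMap (λ t → subjTerm (subj t) ∷ obj t ∷ []) G

Name : Set
Name = ℕ

data Shape : Set where
  ⊥ˢ ⊤ˢ : Shape
  test  : Const → Shape
  nm    : Name → Shape
  ¬ˢ_   : Shape → Shape
  _∨ˢ_  : Shape → Shape → Shape
  _∧ˢ_  : Shape → Shape → Shape
  ∃ˢ    : IRI → Shape → Shape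
  ∀ˢ    : IRI → Shape → Shape

namesOf : Shape → List Name
namesOf ⊥ˢ        = []
namesOf ⊤ˢ        = []
namesOf (test c)  = []
namesOf (nm s)    = s ∷ []
namesOf (¬ˢ φ)    = namesOf φ
namesOf (φ ∨ˢ ψ)  = namesOf φ ++ namesOf ψ
namesOf (φ ∧ˢ ψ)  = namesOf φ ++ namesOf ψ
namesOf (∃ˢ p φ)  = namesOf φ
namesOf (∀ˢ p φ)  = namesOf φ

constsOf : Shape → List Const
constsOf ⊥ˢ        = []
constsOf ⊤ˢ        = []
constsOf (test c)  = c ∷ []
constsOf (nm s)    = []
constsOf (¬ˢ φ)    = constsOf φ
constsOf (φ ∨ˢ ψ)  = constsOf φ ++ constsOf ψ
constsOf (φ ∧ˢ ψ)  = constsOf φ ++ constsOf ψ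
constsOf (∃ˢ p φ)  = constsOf φ
constsOf (∀ˢ p φ)  = constsOf φ

-- A catalogue: a finite domain (list of names) and the declarations;
-- def is only consulted on names in dom.
record Catalogue : Set where
  field
    dom : List Name
    def : Name → Shape
open Catalogue public

WellFormed : Catalogue → Set
WellFormed C = ∀ s → s ∈ dom C → ∀ s' → s' ∈ namesOf (def C s) → s' ∈ dom C

Consts : Catalogue → List Const
Consts C = concatMap (λ s → constsOf (def C s)) (dom C)

_∈ᵇ_ : ℕ → List ℕ → Bool
s ∈ᵇ xs = any (λ x → s ≡ᵇ x) xs

inN : Graph → Catalogue → Term → Bool
inN G C u = any (λ t → u ==T t) (Nodes G)
          ∨ any (λ c → u ==T constTerm c) (Consts C)

Assignment : Set
Assignment = Name → Term → Bool

IsAssignment : Graph → Catalogue → Assignment → Set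
IsAssignment G C α = ∀ s u → α s u ≡ true → (s ∈ dom C) × (inN G C u ≡ true)

⟦_⟧ : Shape → Graph → Catalogue → Assignment → Term → Bool
⟦ ⊥ˢ ⟧ G C α u       = false
⟦ ⊤ˢ ⟧ G C α u       = inN G C u
⟦ test c ⟧ G C α u   = u ==T constTerm c
⟦ nm s ⟧ G C α u     = α s u
⟦ ¬ˢ φ ⟧ G C α u     = inN G C u ∧ not (⟦ φ ⟧ G C α u)
⟦ φ ∨ˢ ψ ⟧ G C α u   = ⟦ φ ⟧ G C α u ∨ ⟦ ψ ⟧ G C α u
⟦ φ ∧ˢ ψ ⟧ G C α u   = ⟦ φ ⟧ G C α u ∧ ⟦ ψ ⟧ G C α u
⟦ ∃ˢ p φ ⟧ G C α u   =
  any (λ t → (subjTerm (subj t) ==T u) ∧ (pred t ≡ᵇ p) ∧ ⟦ φ ⟧ G C α (obj t)) G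
⟦ ∀ˢ p φ ⟧ G C α u   = inN G C u ∧
  all (λ t → not ((subjTerm (subj t) ==T u) ∧ (pred t ≡ᵇ p)) ∨ ⟦ φ ⟧ G C α (obj t)) G

-- Stratifications.  A partition Σ₀,…,Σₙ of dom(C) is given by a level
-- function lvl (s ∈ Σ_{lvl s}).

data StratOK (C : Catalogue) (lvl : Name → ℕ) (i : ℕ) : Shape → Set where
  ok⊥    : StratOK C lvl i ⊥ˢ
  ok⊤    : StratOK C lvl i ⊤ˢ
  oktest : ∀ c → StratOK C lvl i (test c)
  oknm   : ∀ s → s ∈ dom C → lvl s ≤ i → StratOK C lvl i (nm s)
  ok¬test : ∀ c → StratOK C lvl i (¬ˢ test c)
  ok¬nm  : ∀ s → s ∈ dom C → lvl s < i → StratOK C lvl i (¬ˢ nm s)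
  ok∨    : ∀ {φ ψ} → StratOK C lvl i φ → StratOK C lvl i ψ → StratOK C lvl i (φ ∨ˢ ψ)
  ok∧    : ∀ {φ ψ} → StratOK C lvl i φ → StratOK C lvl i ψ → StratOK C lvl i (φ ∧ˢ ψ)
  ok∃    : ∀ {p φ} → StratOK C lvl i φ → StratOK C lvl i (∃ˢ p φ)
  ok∀    : ∀ {p φ} → StratOK C lvl i φ → StratOK C lvl i (∀ˢ p φ)

IsStratification : Catalogue → (Name → ℕ) → Set
IsStratification C lvl = ∀ s → s ∈ dom C → StratOK C lvl (lvl s) (def C s)

Stratified : Catalogue → Set
Stratified C = Σ (Name → ℕ) (λ lvl → IsStratification C lvl)

restrict : (Name → ℕ) → ℕ → Assignment → Assignment
restrict lvl i α s u = (lvl s ≡ᵇ i) ∧ α s u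

extend : (Name → ℕ) → ℕ → Assignment → Assignment → Assignment
extend lvl i α β s u =
  if lvl s <ᵇ i then α s u else (if lvl s ≡ᵇ i then β s u else false)

OverStratum : Graph → Catalogue → (Name → ℕ) → ℕ → Assignment → Set
OverStratum G C lvl i β =
  ∀ s u → β s u ≡ true → (s ∈ dom C) × (lvl s ≡ i) × (inN G C u ≡ true)

-- γ is correct for C_i (the restriction of C to Σ₀ ∪ … ∪ Σᵢ);
-- semantics over the fixed N = Nodes(G) ∪ Const(C).
CorrectUpTo : Graph → Catalogue → (Name → ℕ) → ℕ → Assignment → Set
CorrectUpTo G C lvl i γ =
  ∀ s → s ∈ dom C → lvl s ≤ i → ∀ u → inN G C u ≡ true →
  γ s u ≡ ⟦ def C s ⟧ G C γ u

_⊆ᵃ_ : Assignment → Assignment → Set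
α ⊆ᵃ β = ∀ s u → α s u ≡ true → β s u ≡ true

LeastAt : Graph → Catalogue → (Name → ℕ) → ℕ → Assignment → Set
LeastAt G C lvl i α =
  CorrectUpTo G C lvl i (extend lvl i α (restrict lvl i α)) ×
  (∀ β → OverStratum G C lvl i β → CorrectUpTo G C lvl i (extend lvl i α β) →
     restrict lvl i α ⊆ᵃ β)

GreatestAt : Graph → Catalogue → (Name → ℕ) → ℕ → Assignment → Set
GreatestAt G C lvl i α =
  CorrectUpTo G C lvl i (extend lvl i α (restrict lvl i α)) ×
  (∀ β → OverStratum G C lvl i β → CorrectUpTo G C lvl i (extend lvl i α β) →
     β ⊆ᵃ restrict lvl i α)

LFPConformsWrt : Graph → Catalogue → (Name → ℕ) → Assignment → Set
LFPConformsWrt G C lvl α = IsAssignment G C α × (∀ i → LeastAt G C lvl i α)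

GFPConformsWrt : Graph → Catalogue → (Name → ℕ) → Assignment → Set
GFPConformsWrt G C lvl α = IsAssignment G C α × (∀ i → GreatestAt G C lvl i α)

LFPConforms : Graph → Catalogue → Assignment → Set
LFPConforms G C α = Σ (Name → ℕ) (λ lvl → IsStratification C lvl × LFPConformsWrt G C lvl α)

GFPConforms : Graph → Catalogue → Assignment → Set
GFPConforms G C α = Σ (Name → ℕ) (λ lvl → IsStratification C lvl × GFPConformsWrt G C lvl α)

-- The paper defines the dual only for
-- shapes in which negation occurs as ¬test(c) or ¬s (as in stratified
-- catalogues); on other negations we extend it by ¬φ ↦ ¬(dual φ), a
-- case that never arises for stratified catalogues.

dual : Shape → Shape
dual ⊥ˢ              = ⊤ˢ
dual ⊤ˢ              = ⊥ˢ
dual (test c)        = ¬ˢ test c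
dual (nm s)          = nm s
dual (¬ˢ test c)     = test c
dual (¬ˢ nm s)       = ¬ˢ nm s
dual (¬ˢ φ)          = ¬ˢ dual φ
dual (φ ∨ˢ ψ)        = dual φ ∧ˢ dual ψ
dual (φ ∧ˢ ψ)        = dual φ ∨ˢ dual ψ
dual (∃ˢ p φ)        = ∀ˢ p (dual φ)
dual (∀ˢ p φ)        = ∃ˢ p (dual φ)

dualCat : Catalogue → Catalogue
dualCat C = record { dom = dom C ; def = λ s → dual (def C s) }

complΩ : Graph → Catalogue → Assignment → Assignment
complΩ G C α s u = (s ∈ᵇ dom C) ∧ inN G C u ∧ not (α s u)

-- Complementing within Ω turns a dual shape into the negation of the original one:
-- if δ agrees with N ∖ γ on the strata a shape φ of a stratified catalogue can
-- mention, then ⟦φ̃⟧ at δ is N ∖ ⟦φ⟧ at γ, since dualisation swaps ⊤/⊥, ∧/∨ and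
-- ∃/∀ and stratification confines negation to tests and lower strata. Hence
-- α|Σ<ᵢ ∪ β is correct for Cᵢ exactly when the complemented lower strata together
-- with the complement of β in Σᵢ × N are correct for C̃ᵢ. Complementation reverses
-- inclusion, so least solutions on each stratum correspond to greatest ones.

module Submission where

open import Defs
open import Data.Bool using (Bool; true; false; _∧_; _∨_; not)
open import Data.Bool.Properties
  using (∨-∧-booleanAlgebra; not-involutive; not-injective; T-≡)
open import Algebra.Lattice.Properties.BooleanAlgebra ∨-∧-booleanAlgebra
  using (deMorgan₁; deMorgan₂)
open import Data.Bool.ListAction using (any; all)
open import Data.Nat using (ℕ; zero; suc; _≤_; _<_; _≡ᵇ_; _<ᵇ_)
open import Data.Nat.Properties using (≡ᵇ⇒≡; <⇒<ᵇ; <⇒≤; ≤-trans; m≤n⇒m<n∨m≡n)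
open import Data.List using ([]; _∷_; _++_)
open import Data.List.Properties using (concatMap-cong)
open import Data.List.Membership.Propositional using (_∈_; lose)
open import Data.List.Relation.Unary.Any using (here; there)
import Data.List.Relation.Unary.Any as Any
open import Data.List.Relation.Unary.Any.Properties using (any⁺; any⁻)
open import Data.Product using (_,_; map₂)
open import Data.Sum using (inj₁; inj₂)
open import Function using (_∘_; Equivalence; _⇔_; mk⇔)
open import Relation.Binary.PropositionalEquality

private
  variable
    G : Graph
    C : Catalogue
    lvl lvl′ : Name → ℕ
    i j : ℕ
    φ : Shape
    s : Name
    u : Term
    γ δ γ′ δ′ : Assignment

≡ᵇ-refl : ∀ n → (n ≡ᵇ n) ≡ true
≡ᵇ-refl zero    = refl
≡ᵇ-refl (suc n) = ≡ᵇ-refl n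

<ᵇ-irrefl : ∀ n → (n <ᵇ n) ≡ false
<ᵇ-irrefl zero    = refl
<ᵇ-irrefl (suc n) = <ᵇ-irrefl n

==T-refl : ∀ t → (t ==T t) ≡ true
==T-refl (iri n)   = ≡ᵇ-refl n
==T-refl (blank n) = ≡ᵇ-refl n
==T-refl (lit n)   = ≡ᵇ-refl n

∈ᵇ⇒∈ : ∀ {xs} → (s ∈ᵇ xs) ≡ true → s ∈ xs
∈ᵇ⇒∈ {s} {xs} e = Any.map (≡ᵇ⇒≡ s _) (any⁻ _ xs (Equivalence.from T-≡ e))

∈⇒any : ∀ {A : Set} (p : A → Bool) {x xs} → x ∈ xs → p x ≡ true → any p xs ≡ true
∈⇒any p x∈xs px = Equivalence.to T-≡ (any⁺ p (lose x∈xs (Equivalence.from T-≡ px)))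

∈⇒∈ᵇ : ∀ {xs} → s ∈ xs → (s ∈ᵇ xs) ≡ true
∈⇒∈ᵇ {s} s∈xs = ∈⇒any (s ≡ᵇ_) s∈xs (≡ᵇ-refl s)

≡not-sym : ∀ {a b} → a ≡ not b → b ≡ not a
≡not-sym {b = b} a≡¬b = trans (sym (not-involutive b)) (cong not (sym a≡¬b))

not-antitone : ∀ {a b} → (a ≡ true → b ≡ true) → not b ≡ true → not a ≡ true
not-antitone {false} _   _  = refl
not-antitone {true}  a⇒b ¬b = subst (λ x → not x ≡ true) (a⇒b refl) ¬b

not-∧∨ : ∀ a b {c d} → d ≡ not c → not (a ∧ b) ∨ d ≡ not (a ∧ b ∧ c)
not-∧∨ true  true  d≡¬c = d≡¬c
not-∧∨ true  false _    = refl
not-∧∨ false _     _    = refl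

all≡not-any : ∀ {A : Set} (f g : A → Bool) xs →
              (∀ x → x ∈ xs → f x ≡ not (g x)) → all f xs ≡ not (any g xs)
all≡not-any f g []       _     = refl
all≡not-any f g (x ∷ xs) f≡¬g = begin
  f x ∧ all f xs              ≡⟨ cong₂ _∧_ (f≡¬g x (here refl))
                                   (all≡not-any f g xs (λ y → f≡¬g y ∘ there)) ⟩
  not (g x) ∧ not (any g xs)  ≡⟨ deMorgan₂ (g x) (any g xs) ⟨
  not (g x ∨ any g xs)        ∎
  where open ≡-Reasoning

constsOf-dual : ∀ φ → constsOf (dual φ) ≡ constsOf φ
constsOf-dual ⊥ˢ               = refl
constsOf-dual ⊤ˢ               = refl
constsOf-dual (test c)         = refl
constsOf-dual (nm s)           = refl
constsOf-dual (¬ˢ ⊥ˢ)          = refl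
constsOf-dual (¬ˢ ⊤ˢ)          = refl
constsOf-dual (¬ˢ test c)      = refl
constsOf-dual (¬ˢ nm s)        = refl
constsOf-dual (¬ˢ (¬ˢ φ))      = constsOf-dual (¬ˢ φ)
constsOf-dual (¬ˢ (φ ∨ˢ ψ))    = cong₂ _++_ (constsOf-dual φ) (constsOf-dual ψ)
constsOf-dual (¬ˢ (φ ∧ˢ ψ))    = cong₂ _++_ (constsOf-dual φ) (constsOf-dual ψ)
constsOf-dual (¬ˢ ∃ˢ p φ)      = constsOf-dual φ
constsOf-dual (¬ˢ ∀ˢ p φ)      = constsOf-dual φ
constsOf-dual (φ ∨ˢ ψ)         = cong₂ _++_ (constsOf-dual φ) (constsOf-dual ψ)
constsOf-dual (φ ∧ˢ ψ)         = cong₂ _++_ (constsOf-dual φ) (constsOf-dual ψ)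
constsOf-dual (∃ˢ p φ)         = constsOf-dual φ
constsOf-dual (∀ˢ p φ)         = constsOf-dual φ

StratOK-dual : StratOK C lvl i φ → StratOK (dualCat C) lvl i (dual φ)
StratOK-dual ok⊥                = ok⊤
StratOK-dual ok⊤                = ok⊥
StratOK-dual (oktest c)         = ok¬test c
StratOK-dual (oknm s s∈ le)     = oknm s s∈ le
StratOK-dual (ok¬test c)        = oktest c
StratOK-dual (ok¬nm s s∈ lt)    = ok¬nm s s∈ lt
StratOK-dual (ok∨ ok₁ ok₂)      = ok∧ (StratOK-dual ok₁) (StratOK-dual ok₂)
StratOK-dual (ok∧ ok₁ ok₂)      = ok∨ (StratOK-dual ok₁) (StratOK-dual ok₂)
StratOK-dual (ok∃ ok)           = ok∀ (StratOK-dual ok)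
StratOK-dual (ok∀ ok)           = ok∃ (StratOK-dual ok)

-- dual is not injective (dual (¬ˢ ¬ˢ test c) = dual (test c)); the first
-- argument certifies that φ negates only tests and names, where it is.
StratOK-dual⁻¹ : StratOK C lvl′ j φ → StratOK (dualCat C) lvl i (dual φ) → StratOK C lvl i φ
StratOK-dual⁻¹ ok⊥              _                  = ok⊥
StratOK-dual⁻¹ ok⊤              _                  = ok⊤
StratOK-dual⁻¹ (oktest c)       _                  = oktest c
StratOK-dual⁻¹ (oknm s _ _)     (oknm .s s∈ le)    = oknm s s∈ le
StratOK-dual⁻¹ (ok¬test c)      _                  = ok¬test c
StratOK-dual⁻¹ (ok¬nm s _ _)    (ok¬nm .s s∈ lt)   = ok¬nm s s∈ lt
StratOK-dual⁻¹ (ok∨ ok₁ ok₂)    (ok∧ ok₁′ ok₂′)    = ok∨ (StratOK-dual⁻¹ ok₁ ok₁′) (StratOK-dual⁻¹ ok₂ ok₂′)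
StratOK-dual⁻¹ (ok∧ ok₁ ok₂)    (ok∨ ok₁′ ok₂′)    = ok∧ (StratOK-dual⁻¹ ok₁ ok₁′) (StratOK-dual⁻¹ ok₂ ok₂′)
StratOK-dual⁻¹ (ok∃ ok)         (ok∀ ok′)          = ok∃ (StratOK-dual⁻¹ ok ok′)
StratOK-dual⁻¹ (ok∀ ok)         (ok∃ ok′)          = ok∀ (StratOK-dual⁻¹ ok ok′)

IsStratification-dualCat : IsStratification C lvl′ →
                           IsStratification C lvl ⇔ IsStratification (dualCat C) lvl
IsStratification-dualCat st₀ = mk⇔
  (λ st s s∈ → StratOK-dual (st s s∈))
  (λ st s s∈ → StratOK-dual⁻¹ (st₀ s s∈) (st s s∈))

obj∈Nodes : ∀ {t} → t ∈ G → obj t ∈ Nodes G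
obj∈Nodes (here refl) = there (here refl)
obj∈Nodes (there t∈G) = there (there (obj∈Nodes t∈G))

module _ (G : Graph) (C : Catalogue) where

  inN-dualCat : ∀ u → inN G (dualCat C) u ≡ inN G C u
  inN-dualCat u =
    cong (λ cs → any (u ==T_) (Nodes G) ∨ any (λ c → u ==T constTerm c) cs)
         (concatMap-cong (constsOf-dual ∘ def C) (dom C))

  obj∈N : ∀ {t} → t ∈ G → inN G C (obj t) ≡ true
  obj∈N {t} t∈G =
    cong (_∨ any (λ c → obj t ==T constTerm c) (Consts C))
         (∈⇒any (obj t ==T_) (obj∈Nodes t∈G) (==T-refl (obj t)))

  IsAssignment-dualCat : IsAssignment G C γ → IsAssignment G (dualCat C) γ
  IsAssignment-dualCat isγ s u γsu = map₂ (trans (inN-dualCat u)) (isγ s u γsu)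

  complΩ-IsAssignment : ∀ γ → IsAssignment G C (complΩ G C γ)
  complΩ-IsAssignment γ s u _ with s ∈ᵇ dom C in s∈ | inN G C u
  ... | true | true = ∈ᵇ⇒∈ s∈ , refl

module _ (G : Graph) (C : Catalogue) (lvl : Name → ℕ) where

  OverStratum-dualCat : OverStratum G C lvl i γ ⇔ OverStratum G (dualCat C) lvl i γ
  OverStratum-dualCat = mk⇔
    (λ over s u γsu → map₂ (map₂ (trans (inN-dualCat G C u))) (over s u γsu))
    (λ over s u γsu → map₂ (map₂ (trans (sym (inN-dualCat G C u)))) (over s u γsu))

  restrict-OverStratum : IsAssignment G C γ → OverStratum G C lvl i (restrict lvl i γ)
  restrict-OverStratum {γ} {i} isγ s u _ with lvl s ≡ᵇ i in lvl≡i | γ s u in γsu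
  ... | true | true = let s∈ , u∈N = isγ s u γsu
                      in s∈ , ≡ᵇ⇒≡ (lvl s) i (Equivalence.from T-≡ lvl≡i) , u∈N

  Complementary : (ℕ → Set) → Assignment → Assignment → Set
  Complementary P γ δ =
    ∀ s → s ∈ dom C → P (lvl s) → ∀ u → inN G C u ≡ true → δ s u ≡ not (γ s u)

  Complementary-sym : ∀ P → Complementary P γ δ → Complementary P δ γ
  Complementary-sym _ γ⊥δ s s∈ Ps u u∈N = ≡not-sym (γ⊥δ s s∈ Ps u u∈N)

  complΩ-complementary : ∀ P γ → Complementary P γ (complΩ G C γ)
  complΩ-complementary P γ s s∈ _ u u∈N rewrite ∈⇒∈ᵇ s∈ | u∈N = refl

  restrict-complementary : Complementary (_≡ i) γ δ →
                           Complementary (_≡ i) (restrict lvl i γ) (restrict lvl i δ)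
  restrict-complementary γ⊥δ s s∈ refl u u∈N rewrite ≡ᵇ-refl (lvl s) = γ⊥δ s s∈ refl u u∈N

  extend-complementary : Complementary (_< i) γ δ → Complementary (_≡ i) γ′ δ′ →
                         Complementary (_≤ i) (extend lvl i γ γ′) (extend lvl i δ δ′)
  extend-complementary below at s s∈ le u u∈N with m≤n⇒m<n∨m≡n le
  ... | inj₁ lt   rewrite Equivalence.to T-≡ (<⇒<ᵇ lt) = below s s∈ lt u u∈N
  ... | inj₂ refl rewrite <ᵇ-irrefl (lvl s) | ≡ᵇ-refl (lvl s) = at s s∈ refl u u∈N

  complement-⊆ : Complementary (_≡ i) γ δ → Complementary (_≡ i) γ′ δ′ →
                 OverStratum G C lvl i δ′ → γ ⊆ᵃ γ′ → δ′ ⊆ᵃ δ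
  complement-⊆ γ⊥δ γ′⊥δ′ over γ⊆γ′ s u δ′su =
    let s∈ , lvl≡i , u∈N = over s u δ′su
    in trans (γ⊥δ s s∈ lvl≡i u u∈N)
             (not-antitone (γ⊆γ′ s u) (trans (sym (γ′⊥δ′ s s∈ lvl≡i u u∈N)) δ′su))

  complementAt : ℕ → Assignment → Assignment
  complementAt i γ = restrict lvl i (complΩ G C γ)

  complementAt-complementary : ∀ γ → Complementary (_≡ i) γ (complementAt i γ)
  complementAt-complementary γ s s∈ refl u u∈N rewrite ≡ᵇ-refl (lvl s) =
    complΩ-complementary (_≡ lvl s) γ s s∈ refl u u∈N

  dual-semantics : StratOK C lvl j φ → Complementary (_≤ j) γ δ → inN G C u ≡ true →
                   ⟦ dual φ ⟧ G (dualCat C) δ u ≡ not (⟦ φ ⟧ G C γ u)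
  dual-semantics {u = u} ok⊥ _ u∈N = trans (inN-dualCat G C u) u∈N
  dual-semantics ok⊤ _ u∈N = cong not (sym u∈N)
  dual-semantics {u = u} (oktest c) _ u∈N =
    cong (_∧ not (u ==T constTerm c)) (trans (inN-dualCat G C u) u∈N)
  dual-semantics (oknm s s∈ le) γ⊥δ u∈N = γ⊥δ s s∈ le _ u∈N
  dual-semantics (ok¬test c) _ u∈N rewrite u∈N = sym (not-involutive _)
  dual-semantics {u = u} (ok¬nm s s∈ lt) γ⊥δ u∈N
    rewrite inN-dualCat G C u | u∈N | γ⊥δ s s∈ (<⇒≤ lt) u u∈N = refl
  dual-semantics {γ = γ} {u = u} (ok∨ {φ} {ψ} ok₁ ok₂) γ⊥δ u∈N =
    trans (cong₂ _∧_ (dual-semantics ok₁ γ⊥δ u∈N) (dual-semantics ok₂ γ⊥δ u∈N))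
          (sym (deMorgan₂ (⟦ φ ⟧ G C γ u) (⟦ ψ ⟧ G C γ u)))
  dual-semantics {γ = γ} {u = u} (ok∧ {φ} {ψ} ok₁ ok₂) γ⊥δ u∈N =
    trans (cong₂ _∨_ (dual-semantics ok₁ γ⊥δ u∈N) (dual-semantics ok₂ γ⊥δ u∈N))
          (sym (deMorgan₁ (⟦ φ ⟧ G C γ u) (⟦ ψ ⟧ G C γ u)))
  dual-semantics {u = u} (ok∃ {p} ok) γ⊥δ u∈N rewrite inN-dualCat G C u | u∈N =
    all≡not-any _ _ G λ t t∈G →
      not-∧∨ (subjTerm (subj t) ==T u) (pred t ≡ᵇ p)
             (dual-semantics ok γ⊥δ (obj∈N G C t∈G))
  dual-semantics {u = u} (ok∀ {p} ok) γ⊥δ u∈N rewrite u∈N =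
    ≡not-sym (all≡not-any _ _ G λ t t∈G →
      not-∧∨ (subjTerm (subj t) ==T u) (pred t ≡ᵇ p)
             (≡not-sym (dual-semantics ok γ⊥δ (obj∈N G C t∈G))))

  CorrectUpTo-dual : IsStratification C lvl → Complementary (_≤ i) γ δ →
                     CorrectUpTo G C lvl i γ ⇔ CorrectUpTo G (dualCat C) lvl i δ
  CorrectUpTo-dual {i} {γ} {δ} st γ⊥δ = mk⇔
    (λ correct s s∈ le u u∈N′ → let u∈N = trans (sym (inN-dualCat G C u)) u∈N′ in
       trans (γ⊥δ s s∈ le u u∈N)
             (trans (cong not (correct s s∈ le u u∈N)) (sym (declaration s∈ le u∈N))))
    (λ correct s s∈ le u u∈N → not-injective
       (trans (sym (γ⊥δ s s∈ le u u∈N))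
              (trans (correct s s∈ le u (trans (inN-dualCat G C u) u∈N)) (declaration s∈ le u∈N))))
    where
    declaration : s ∈ dom C → lvl s ≤ i → inN G C u ≡ true →
                  ⟦ dual (def C s) ⟧ G (dualCat C) δ u ≡ not (⟦ def C s ⟧ G C γ u)
    declaration {s} s∈ le =
      dual-semantics (st s s∈) (λ s′ s′∈ le′ → γ⊥δ s′ s′∈ (≤-trans le′ le))

  strata-complementary : ∀ α i →
    Complementary (_≤ i) (extend lvl i α (restrict lvl i α))
                         (extend lvl i (complΩ G C α) (restrict lvl i (complΩ G C α)))
  strata-complementary α i =
    extend-complementary (complΩ-complementary (_< i) α)
                         (restrict-complementary (complΩ-complementary (_≡ i) α))

  LeastAt⇒GreatestAt-dual : IsStratification C lvl → ∀ α i → LeastAt G C lvl i α →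
                            GreatestAt G (dualCat C) lvl i (complΩ G C α)
  LeastAt⇒GreatestAt-dual st α i (correct , least) =
    Equivalence.to (CorrectUpTo-dual st (strata-complementary α i)) correct , greatest
    where
    greatest : ∀ β → OverStratum G (dualCat C) lvl i β →
               CorrectUpTo G (dualCat C) lvl i (extend lvl i (complΩ G C α) β) →
               β ⊆ᵃ restrict lvl i (complΩ G C α)
    greatest β over correct-β =
      complement-⊆ (restrict-complementary (complΩ-complementary (_≡ i) α)) β′⊥β
        (Equivalence.from OverStratum-dualCat over)
        (least (complementAt i β) (restrict-OverStratum (complΩ-IsAssignment G C β))
          (Equivalence.from (CorrectUpTo-dual st
             (extend-complementary (complΩ-complementary (_< i) α) β′⊥β)) correct-β))
      where β′⊥β = Complementary-sym (_≡ i) (complementAt-complementary β)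

  GreatestAt-dual⇒LeastAt : IsStratification C lvl → ∀ α → IsAssignment G C α → ∀ i →
                            GreatestAt G (dualCat C) lvl i (complΩ G C α) → LeastAt G C lvl i α
  GreatestAt-dual⇒LeastAt st α isα i (correct , greatest) =
    Equivalence.from (CorrectUpTo-dual st (strata-complementary α i)) correct , least
    where
    least : ∀ β → OverStratum G C lvl i β → CorrectUpTo G C lvl i (extend lvl i α β) →
            restrict lvl i α ⊆ᵃ β
    least β over correct-β =
      complement-⊆ (Complementary-sym (_≡ i) β⊥β′)
        (Complementary-sym (_≡ i) (restrict-complementary (complΩ-complementary (_≡ i) α)))
        (restrict-OverStratum isα)
        (greatest (complementAt i β)
          (Equivalence.to OverStratum-dualCat (restrict-OverStratum (complΩ-IsAssignment G C β)))
          (Equivalence.to (CorrectUpTo-dual st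
             (extend-complementary (complΩ-complementary (_< i) α) β⊥β′)) correct-β))
      where β⊥β′ = complementAt-complementary β

proposition1 : (G : Graph) (C : Catalogue) → WellFormed C → Stratified C →
               (α : Assignment) → IsAssignment G C α →
               LFPConforms G C α ⇔ GFPConforms G (dualCat C) (complΩ G C α)
proposition1 G C _ (_ , st₀) α isα = mk⇔
  (λ (lvl , st , _ , least) →
     lvl , Equivalence.to (IsStratification-dualCat st₀) st ,
     IsAssignment-dualCat G C (complΩ-IsAssignment G C α) ,
     λ i → LeastAt⇒GreatestAt-dual G C lvl st α i (least i))
  (λ (lvl , st′ , _ , greatest) →
     let st = Equivalence.from (IsStratification-dualCat st₀) st′
     in lvl , st , isα , λ i → GreatestAt-dual⇒LeastAt G C lvl st α isα i (greatest i))
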